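{- Let $\alpha=\frac{1}{e-1}$ and $g(t)=e^{t-1}$. Fix an edge $(w,v)\in E$ and fix the values $t_{v'}$ for all $v'\in R\setminus\{v\}$. Run Greedy-with-duals (described in the context) on $G$ with $v$ removed, using these values, and let $t^c$ be the value $t_{v'}$ of the online vertex $v'$ during whose processing $y_w$ is set, or $t^c=1$ if $y_w$ is never set in that run. Then, in the run of Greedy-with-duals on $G$ (with the same values $t_{v'}$, $v'\ne v$), the final value of $y_w$ satisfies $y_w\ge(1+\alpha)(1-g(t^c))$, regardless of the value of $t_v$.
   Context: $G=(L,R,E)$ is bipartite, $N(v)$ is the neighbourhood of $v$, and $f:2^L\to\mathbb{Z}_{\ge0}$ is a matroid rank function ($f(\emptyset)=0$, $f(S\cup\{u\})-f(S)\in\{0,1\}$, $f$ submodular). $\mathrm{span}(M)=\{u\in L: f(M\cup\{u\})=f(M)\}$. Each $v\in R$ has a value $t_v\in[0,1]$, and the vertices of $R$ arrive in increasing order of $t_v$ (with their incident edges); each $v$ has a fixed preference ordering $\sigma^{(v)}$ of its neighbours. Greedy-with-duals: initially $M_L=\emptyset$ and all $x_{uv},y_u,z_v$ are $0$. When $v$ arrives: if $N(v)\subseteq\mathrm{span}(M_L)$ do nothing; otherwise let $u$ be the first vertex of $N(v)\setminus\mathrm{span}(M_L)$ in $\sigma^{(v)}$, set $x_{uv}=1$, $z_v=(1+\alpha)g(t_v)$, set $y_w\leftarrow(1+\alpha)(1-g(t_v))$ for every $w\in\mathrm{span}(M_L\cup\{u\})\setminus\mathrm{span}(M_L)$, and set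 $M_L\leftarrow M_L\cup\{u\}$. -}

module Defs where

open import Level using (0ℓ)
open import Data.Nat as ℕ using (ℕ; suc)
open import Data.Bool using (Bool; true; false; if_then_else_)
open import Data.Fin using (Fin)
open import Data.Fin.Subset using (Subset; ⁅_⁆; _∪_; _∩_)
import Data.Fin.Subset as Sub
open import Data.Fin.Properties using () renaming (_≟_ to _≟ᶠ_)
open import Data.List using (List; []; _∷_; foldl; filter; allFin)
open import Data.List.Membership.Propositional using (_∈_)
open import Data.List.Relation.Unary.Unique.Propositional using (Unique)
open import Data.List.Relation.Unary.Linked using (Linked)
open import Data.List.Relation.Binary.Permutation.Propositional using (_↭_)
open import Data.Maybe using (Maybe; just; nothing; maybe)
open import Data.Product using (_×_)
open import Data.Sum using (_⊎_)
open import Relation.Nullary using (¬_; yes; no)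
open import Relation.Nullary.Decidable using (⌊_⌋)
open import Relation.Binary using (Rel; IsTotalOrder)
open import Relation.Binary.PropositionalEquality using (_≡_; _≢_)
open import Algebra.Structures using (IsCommutativeRing)
open import Function using (_⇔_)

-- Abstract real numbers: a (totally) ordered field with an exponential
-- function characterised by exp(x+y) = exp x * exp y and exp x ≥ 1 + x.

record OrderedFieldExp : Set₁ where
  infixl 6 _+_
  infixl 7 _*_
  infix 4 _≤_
  field
    Carrier : Set
    _+_ _*_ : Carrier → Carrier → Carrier
    -_ : Carrier → Carrier
    0# 1# : Carrier
    isCommutativeRing : IsCommutativeRing _≡_ _+_ _*_ -_ 0# 1#
    _≤_ : Rel Carrier 0ℓ
    ≤-isTotalOrder : IsTotalOrder _≡_ _≤_
    +-mono-≤ : ∀ {x y} z → x ≤ y → x + z ≤ y + z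
    *-nonneg : ∀ {x y} → 0# ≤ x → 0# ≤ y → 0# ≤ x * y
    0≢1 : 0# ≢ 1#
    _⁻¹ : Carrier → Carrier
    ⁻¹-inverse : ∀ x → x ≢ 0# → x * (x ⁻¹) ≡ 1#
    exp : Carrier → Carrier
    exp-+ : ∀ x y → exp (x + y) ≡ exp x * exp y
    exp-≥ : ∀ x → 1# + x ≤ exp x

  _-_ : Carrier → Carrier → Carrier
  x - y = x + (- y)

  e : Carrier
  e = exp 1#

  α : Carrier
  α = (e - 1#) ⁻¹

  g : Carrier → Carrier
  g t = exp (t - 1#)

record IsMatroidRank {nL : ℕ} (f : Subset nL → ℕ) : Set where
  field
    f-empty : f Sub.⊥ ≡ 0
    f-unit  : ∀ S u → (f (S ∪ ⁅ u ⁆) ≡ f S) ⊎ (f (S ∪ ⁅ u ⁆) ≡ suc (f S))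
    f-submodular : ∀ A B → f (A ∪ B) ℕ.+ f (A ∩ B) ℕ.≤ f A ℕ.+ f B

inSpan : {nL : ℕ} → (Subset nL → ℕ) → Subset nL → Fin nL → Bool
inSpan f M u = ⌊ f (M ∪ ⁅ u ⁆) ℕ.≟ f M ⌋

-- Instance: bipartite graph G = (L, R, E) with L = Fin nL, R = Fin nR,
-- a rank function on L, and for every v ∈ R a preference ordering σ v of
-- N(v) (a duplicate-free list whose elements are exactly N(v)).

record Instance (nL nR : ℕ) : Set where
  field
    E : Fin nL → Fin nR → Bool
    f : Subset nL → ℕ
    f-rank : IsMatroidRank f
    σ : Fin nR → List (Fin nL)
    σ-unique : ∀ v → Unique (σ v)
    σ-nbhd : ∀ v u → (u ∈ σ v) ⇔ (E u v ≡ true)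

module Greedy (ℝ : OrderedFieldExp) {nL nR : ℕ} (I : Instance nL nR)
              (t : Fin nR → OrderedFieldExp.Carrier ℝ) where
  open OrderedFieldExp ℝ
  open Instance I

  record State : Set where
    constructor mkState
    field
      ML : Subset nL
      x  : Fin nL → Fin nR → Carrier
      y  : Fin nL → Carrier
      z  : Fin nR → Carrier
      -- the value t_{v'} of the online vertex during whose processing y_u
      -- was (last) set, or nothing if y_u has never been set
      ySetAt : Fin nL → Maybe Carrier

  initial : State
  initial = mkState Sub.⊥ (λ _ _ → 0#) (λ _ → 0#) (λ _ → 0#) (λ _ → nothing)

  firstUnspanned : Subset nL → List (Fin nL) → Maybe (Fin nL)
  firstUnspanned M [] = nothing
  firstUnspanned M (u ∷ us) with inSpan f M u
  ... | true  = firstUnspanned M us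
  ... | false = just u

  newlySpanned : Subset nL → Fin nL → Fin nL → Bool
  newlySpanned M u w with inSpan f (M ∪ ⁅ u ⁆) w | inSpan f M w
  ... | true | false = true
  ... | _    | _     = false

  step : State → Fin nR → State
  step s v with firstUnspanned (State.ML s) (σ v)
  ... | nothing = s
  ... | just u = mkState
        (ML ∪ ⁅ u ⁆)
        (λ u' v' → if ⌊ u' ≟ᶠ u ⌋ then (if ⌊ v' ≟ᶠ v ⌋ then 1# else x u' v') else x u' v')
        (λ w → if newlySpanned ML u w then (1# + α) * (1# - g (t v)) else y w)
        (λ v' → if ⌊ v' ≟ᶠ v ⌋ then (1# + α) * g (t v) else z v')
        (λ w → if newlySpanned ML u w then just (t v) else ySetAt w)
    where open State s

  run : List (Fin nR) → State
  run = foldl step initial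

IsArrivalOrder : (ℝ : OrderedFieldExp) {nR : ℕ} →
                 (Fin nR → OrderedFieldExp.Carrier ℝ) → List (Fin nR) → Set
IsArrivalOrder ℝ {nR} t order =
  (order ↭ allFin nR) × Linked (λ a b → OrderedFieldExp._≤_ ℝ (t a) (t b)) order

removeVertex : {nR : ℕ} → Fin nR → List (Fin nR) → List (Fin nR)
removeVertex v = filter (λ v' → ¬? (v' ≟ᶠ v))
  where open import Relation.Nullary using (¬?)

module Submission where

-- Compare the run on G with the run on G - v, processing the same vertices in the same order.
-- The full run's independent set always spans everything the reduced run's set spans: when
-- both pick a vertex for the same arrival, the reduced run's pick is either the same vertex or,
-- coming earlier in the preference list, already spanned by the full run.  Hence when
-- y_w is set in the reduced run at time t^c, w is already spanned in the full run, so y_w was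
-- set there at some earlier time t' ≤ t^c, to (1+α)(1-g(t')) ≥ (1+α)(1-g(t^c)).  If y_w is never
-- set in the reduced run, the bound (1+α)(1-g(1)) ≤ 0 is trivial.

open import Defs
open import Algebra.Bundles using (Ring)
open import Algebra.Structures using (IsCommutativeRing; IsRing)
import Algebra.Properties.Ring as RingProperties
import Algebra.Properties.Group as GroupProperties
import Algebra.Solver.IdempotentCommutativeMonoid as ∪-Solver
open import Data.Nat as ℕ using (ℕ; zero; suc)
import Data.Nat.Properties as ℕ
open import Data.Bool using (true; false; _∨_)
open import Data.Bool.Properties using (∨-identityʳ)
open import Data.Empty using (⊥-elim)
open import Data.Fin using (Fin)
open import Data.Fin.Properties using () renaming (_≟_ to _≟ᶠ_)
open import Data.Fin.Subset using (Subset; ⁅_⁆; _∪_; _∩_)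
import Data.Fin.Subset as Subset
open import Data.Fin.Subset.Properties using (∪-identityʳ; ∪-idem; ∪-distribˡ-∩; ∪-idempotentCommutativeMonoid)
open import Data.List using (List; []; _∷_; foldl)
open import Data.List.Membership.Propositional using (_∈_)
open import Data.List.Relation.Unary.Any using (here; there)
open import Data.List.Relation.Unary.All as All using (All; []; _∷_)
open import Data.List.Relation.Unary.AllPairs using (AllPairs; []; _∷_)
open import Data.List.Relation.Unary.Linked.Properties using (Linked⇒AllPairs)
open import Data.Maybe using (just; nothing; maybe)
open import Data.Product using (Σ; _×_; _,_; proj₁; proj₂)
open import Data.Sum using (_⊎_; inj₁; inj₂)
open import Data.Vec using ([]; _∷_)
open import Function using (id)
open import Relation.Binary using (IsTotalOrder)
open import Relation.Binary.PropositionalEquality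
open import Relation.Nullary using (¬_; yes; no; contradiction)

module OrderedFieldExpProperties (ℝ : OrderedFieldExp) where
  open OrderedFieldExp ℝ
  open IsCommutativeRing isCommutativeRing using (isRing)
  open IsRing isRing using (+-assoc; +-comm; +-identityˡ; +-identityʳ; -‿inverseʳ; zeroʳ; *-identityʳ)
  open IsTotalOrder ≤-isTotalOrder using (total) renaming (trans to ≤-trans; antisym to ≤-antisym)

  ring : Ring _ _
  ring = record { isRing = isRing }
  open RingProperties ring using (-‿distribʳ-*; -‿involutive; -0#≈0#; x[y-z]≈xy-xz)
  open GroupProperties (Ring.+-group ring) using (//-rightDividesˡ; //-rightDividesʳ; \\-leftDividesˡ; \\-leftDividesʳ)
  open ≡-Reasoning

  x≤y⇒0≤y-x : ∀ {x y} → x ≤ y → 0# ≤ y - x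
  x≤y⇒0≤y-x {x} p = subst (_≤ _) (-‿inverseʳ x) (+-mono-≤ (- x) p)

  0≤y-x⇒x≤y : ∀ {x y} → 0# ≤ y - x → x ≤ y
  0≤y-x⇒x≤y {x} {y} p = subst₂ _≤_ (+-identityˡ x) (//-rightDividesˡ x y) (+-mono-≤ x p)

  +-monoʳ-≤ : ∀ {x y} z → x ≤ y → z + x ≤ z + y
  +-monoʳ-≤ {x} {y} z p = subst₂ _≤_ (+-comm x z) (+-comm y z) (+-mono-≤ z p)

  neg-mono-≤ : ∀ {x y} → x ≤ y → - y ≤ - x
  neg-mono-≤ {x} {y} p = 0≤y-x⇒x≤y (subst (0# ≤_) y-x≡-x+--y (x≤y⇒0≤y-x p))
    where
    y-x≡-x+--y : y - x ≡ - x + - - y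
    y-x≡-x+--y = trans (+-comm y (- x)) (cong (- x +_) (sym (-‿involutive y)))

  *-monoʳ-≤-nonNeg : ∀ {c x y} → 0# ≤ c → x ≤ y → c * x ≤ c * y
  *-monoʳ-≤-nonNeg {c} {x} {y} 0≤c p =
    0≤y-x⇒x≤y (subst (0# ≤_) (x[y-z]≈xy-xz c y x) (*-nonneg 0≤c (x≤y⇒0≤y-x p)))

  0≤1 : 0# ≤ 1#
  0≤1 with total 0# 1#
  ... | inj₁ 0≤1 = 0≤1
  ... | inj₂ 1≤0 = subst (0# ≤_) -1*-1≡1 (*-nonneg 0≤-1 0≤-1)
    where
    0≤-1 : 0# ≤ - 1#
    0≤-1 = subst (_≤ - 1#) -0#≈0# (neg-mono-≤ 1≤0)
    -1*-1≡1 : - 1# * - 1# ≡ 1#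
    -1*-1≡1 = begin
      - 1# * - 1#   ≡⟨ -‿distribʳ-* (- 1#) 1# ⟨
      - (- 1# * 1#) ≡⟨ cong -_ (*-identityʳ (- 1#)) ⟩
      - - 1#        ≡⟨ -‿involutive 1# ⟩
      1#            ∎

  1≰0 : ¬ 1# ≤ 0#
  1≰0 1≤0 = 0≢1 (≤-antisym 0≤1 1≤0)

  1≤e-1 : 1# ≤ e - 1#
  1≤e-1 = subst (_≤ e - 1#) (//-rightDividesʳ 1# 1#) (+-mono-≤ (- 1#) (exp-≥ 1#))

  0≤α : 0# ≤ α
  0≤α with total 0# α
  ... | inj₁ 0≤α = 0≤α
  ... | inj₂ α≤0 = ⊥-elim (1≰0 (subst₂ _≤_ (-‿involutive 1#) -0#≈0# (neg-mono-≤ 0≤-1)))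
    where
    e-1≢0 : e - 1# ≢ 0#
    e-1≢0 e-1≡0 = 1≰0 (subst (1# ≤_) e-1≡0 1≤e-1)
    0≤-1 : 0# ≤ - 1#
    0≤-1 = subst (0# ≤_) (trans (sym (-‿distribʳ-* (e - 1#) α)) (cong -_ (⁻¹-inverse (e - 1#) e-1≢0)))
             (*-nonneg (≤-trans 0≤1 1≤e-1) (subst (_≤ - α) -0#≈0# (neg-mono-≤ α≤0)))

  0≤1+α : 0# ≤ 1# + α
  0≤1+α = ≤-trans 0≤1 (subst (_≤ 1# + α) (+-identityʳ 1#) (+-monoʳ-≤ 1# 0≤α))

  0≤x⇒1≤exp : ∀ {x} → 0# ≤ x → 1# ≤ exp x
  0≤x⇒1≤exp {x} 0≤x = ≤-trans (subst (_≤ 1# + x) (+-identityʳ 1#) (+-monoʳ-≤ 1# 0≤x)) (exp-≥ x)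

  g-nonneg : ∀ {a} → 0# ≤ a → 0# ≤ g a
  g-nonneg {a} 0≤a = ≤-trans 0≤a (subst (_≤ g a) 1+[a-1]≡a (exp-≥ (a - 1#)))
    where
    1+[a-1]≡a : 1# + (a - 1#) ≡ a
    1+[a-1]≡a = trans (cong (1# +_) (+-comm a (- 1#))) (\\-leftDividesˡ 1# a)

  g-shift : ∀ a b → g a * exp (b - a) ≡ g b
  g-shift a b = begin
    exp (a - 1#) * exp (b - a)    ≡⟨ exp-+ (a - 1#) (b - a) ⟨
    exp ((a - 1#) + (b - a))      ≡⟨ cong exp (+-comm (a - 1#) (b - a)) ⟩
    exp ((b - a) + (a - 1#))      ≡⟨ cong exp (+-assoc b (- a) (a - 1#)) ⟩
    exp (b + (- a + (a - 1#)))    ≡⟨ cong (λ z → exp (b + z)) (\\-leftDividesʳ a (- 1#)) ⟩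
    exp (b - 1#)                  ∎

  g-mono-≤ : ∀ {a b} → 0# ≤ a → a ≤ b → g a ≤ g b
  g-mono-≤ {a} {b} 0≤a a≤b = subst₂ _≤_ (*-identityʳ (g a)) (g-shift a b)
    (*-monoʳ-≤-nonNeg (g-nonneg 0≤a) (0≤x⇒1≤exp (x≤y⇒0≤y-x a≤b)))

  dualValue : Carrier → Carrier
  dualValue t = (1# + α) * (1# - g t)

  dualValue-antimono : ∀ {a b} → 0# ≤ a → a ≤ b → dualValue b ≤ dualValue a
  dualValue-antimono 0≤a a≤b =
    *-monoʳ-≤-nonNeg 0≤1+α (+-monoʳ-≤ 1# (neg-mono-≤ (g-mono-≤ 0≤a a≤b)))

  dualValue-1≤0 : dualValue 1# ≤ 0#
  dualValue-1≤0 = subst (dualValue 1# ≤_) (zeroʳ (1# + α)) (*-monoʳ-≤-nonNeg 0≤1+α 1-g1≤0)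
    where
    1≤g1 : 1# ≤ g 1#
    1≤g1 = subst (_≤ g 1#) (trans (cong (1# +_) (-‿inverseʳ 1#)) (+-identityʳ 1#)) (exp-≥ (1# - 1#))
    1-g1≤0 : 1# - g 1# ≤ 0#
    1-g1≤0 = subst (1# - g 1# ≤_) (-‿inverseʳ (g 1#)) (+-mono-≤ (- g 1#) 1≤g1)

monotone-from-singletons : ∀ {n} (h : Subset n → ℕ) →
  (∀ S u → h S ℕ.≤ h (S ∪ ⁅ u ⁆)) → ∀ S X → h S ℕ.≤ h (S ∪ X)
monotone-from-singletons {zero} h h-mono [] [] = ℕ.≤-refl
monotone-from-singletons {suc n} h h-mono (s ∷ S) (x ∷ X) =
  ℕ.≤-trans (head-mono s x) (monotone-from-singletons (λ Y → h ((s ∨ x) ∷ Y)) tail-mono S X)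
  where
  tail-mono : ∀ Y u → h ((s ∨ x) ∷ Y) ℕ.≤ h ((s ∨ x) ∷ (Y ∪ ⁅ u ⁆))
  tail-mono Y u = subst (λ b → h ((s ∨ x) ∷ Y) ℕ.≤ h (b ∷ (Y ∪ ⁅ u ⁆)))
    (∨-identityʳ (s ∨ x)) (h-mono ((s ∨ x) ∷ Y) (Fin.suc u))
  head-mono : ∀ s x → h (s ∷ S) ℕ.≤ h ((s ∨ x) ∷ S)
  head-mono true  _     = ℕ.≤-refl
  head-mono false false = ℕ.≤-refl
  head-mono false true  = subst (λ Z → h (false ∷ S) ℕ.≤ h (true ∷ Z)) (∪-identityʳ S) (h-mono (false ∷ S) Fin.zero)

module MatroidRankProperties {n : ℕ} {f : Subset n → ℕ} (isRank : IsMatroidRank f) where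
  open IsMatroidRank isRank
  open ∪-Solver (∪-idempotentCommutativeMonoid n)

  -- Spans S X says X ⊆ span(S).
  Spans : Subset n → Subset n → Set
  Spans S X = f (S ∪ X) ≡ f S

  f-mono-⁅⁆ : ∀ S u → f S ℕ.≤ f (S ∪ ⁅ u ⁆)
  f-mono-⁅⁆ S u with f-unit S u
  ... | inj₁ eq = ℕ.≤-reflexive (sym eq)
  ... | inj₂ eq = subst (f S ℕ.≤_) (sym eq) (ℕ.n≤1+n (f S))

  f-mono-∪ : ∀ S X → f S ℕ.≤ f (S ∪ X)
  f-mono-∪ = monotone-from-singletons f f-mono-⁅⁆

  spans-weaken : ∀ {S X} T → Spans S X → Spans (S ∪ T) X
  spans-weaken {S} {X} T S⊒X = ℕ.≤-antisym [S∪T]∪X≤S∪T (f-mono-∪ (S ∪ T) X)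
    where
    S≤[S∪X]∩[S∪T] : f S ℕ.≤ f ((S ∪ X) ∩ (S ∪ T))
    S≤[S∪X]∩[S∪T] = subst (λ Z → f S ℕ.≤ f Z) (∪-distribˡ-∩ S X T) (f-mono-∪ S (X ∩ T))
    [S∪T]∪X≤S∪T : f ((S ∪ T) ∪ X) ℕ.≤ f (S ∪ T)
    [S∪T]∪X≤S∪T = ℕ.+-cancelʳ-≤ (f S) _ _ (begin
      f ((S ∪ T) ∪ X) ℕ.+ f S                          ≡⟨ cong (λ Z → f Z ℕ.+ f S) (solve 3 (λ S X T → (S ⊕ T) ⊕ X ⊜ (S ⊕ X) ⊕ (S ⊕ T)) refl S X T) ⟩
      f ((S ∪ X) ∪ (S ∪ T)) ℕ.+ f S                    ≤⟨ ℕ.+-monoʳ-≤ _ S≤[S∪X]∩[S∪T] ⟩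
      f ((S ∪ X) ∪ (S ∪ T)) ℕ.+ f ((S ∪ X) ∩ (S ∪ T))  ≤⟨ f-submodular (S ∪ X) (S ∪ T) ⟩
      f (S ∪ X) ℕ.+ f (S ∪ T)                          ≡⟨ cong (ℕ._+ f (S ∪ T)) S⊒X ⟩
      f S ℕ.+ f (S ∪ T)                                ≡⟨ ℕ.+-comm (f S) (f (S ∪ T)) ⟩
      f (S ∪ T) ℕ.+ f S                                ∎)
      where open ℕ.≤-Reasoning

  spans-trans : ∀ {S X Y} → Spans S X → Spans X Y → Spans S Y
  spans-trans {S} {X} {Y} S⊒X X⊒Y = ℕ.≤-antisym S∪Y≤S (f-mono-∪ S Y)
    where
    open ℕ.≤-Reasoning
    S∪Y≤S : f (S ∪ Y) ℕ.≤ f S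
    S∪Y≤S = begin
      f (S ∪ Y)        ≤⟨ f-mono-∪ (S ∪ Y) X ⟩
      f ((S ∪ Y) ∪ X)  ≡⟨ cong f (solve 3 (λ S X Y → (S ⊕ Y) ⊕ X ⊜ (X ⊕ S) ⊕ Y) refl S X Y) ⟩
      f ((X ∪ S) ∪ Y)  ≡⟨ spans-weaken S X⊒Y ⟩
      f (X ∪ S)        ≡⟨ cong f (solve 2 (λ S X → X ⊕ S ⊜ S ⊕ X) refl S X) ⟩
      f (S ∪ X)        ≡⟨ S⊒X ⟩
      f S              ∎

  spans-∪ : ∀ {S X Y} → Spans S X → Spans S Y → Spans S (X ∪ Y)
  spans-∪ {S} {X} {Y} S⊒X S⊒Y = begin
    f (S ∪ (X ∪ Y))  ≡⟨ cong f (solve 3 (λ S X Y → S ⊕ (X ⊕ Y) ⊜ (S ⊕ X) ⊕ Y) refl S X Y) ⟩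
    f ((S ∪ X) ∪ Y)  ≡⟨ spans-weaken X S⊒Y ⟩
    f (S ∪ X)        ≡⟨ S⊒X ⟩
    f S              ∎
    where open ≡-Reasoning

  spans-self : ∀ S X → Spans (S ∪ X) X
  spans-self S X = cong f (solve 2 (λ S X → (S ⊕ X) ⊕ X ⊜ S ⊕ X) refl S X)

  spans⇒inSpan : ∀ {M u} → Spans M ⁅ u ⁆ → inSpan f M u ≡ true
  spans⇒inSpan {M} {u} p with f (M ∪ ⁅ u ⁆) ℕ.≟ f M
  ... | yes _  = refl
  ... | no ¬p = contradiction p ¬p

  inSpan⇒spans : ∀ {M u} → inSpan f M u ≡ true → Spans M ⁅ u ⁆
  inSpan⇒spans {M} {u} p with f (M ∪ ⁅ u ⁆) ℕ.≟ f M
  inSpan⇒spans _  | yes q = q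
  inSpan⇒spans () | no _

module GreedyProperties (ℝ : OrderedFieldExp) {nL nR : ℕ} (I : Instance nL nR)
                        (t : Fin nR → OrderedFieldExp.Carrier ℝ) where
  open OrderedFieldExp ℝ
  open OrderedFieldExpProperties ℝ
  open Instance I
  open MatroidRankProperties f-rank
  open Greedy ℝ I t
  open State

  _∈span_ _∉span_ : Fin nL → Subset nL → Set
  a ∈span M = inSpan f M a ≡ true
  a ∉span M = inSpan f M a ≡ false

  spans-∈span : ∀ {M M' a} → Spans M M' → a ∈span M' → a ∈span M
  spans-∈span M⊒M' a∈M' = spans⇒inSpan (spans-trans M⊒M' (inSpan⇒spans a∈M'))

  firstUnspanned-∈ : ∀ {M l u} → firstUnspanned M l ≡ just u → u ∈ l
  firstUnspanned-∈ {M} {b ∷ l} eq with inSpan f M b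
  ... | true = there (firstUnspanned-∈ eq)
  firstUnspanned-∈ {M} {b ∷ l} refl | false = here refl

  firstUnspanned≡nothing⇒∈span : ∀ {M l a} → firstUnspanned M l ≡ nothing → a ∈ l → a ∈span M
  firstUnspanned≡nothing⇒∈span {M} {b ∷ l} eq a∈l with inSpan f M b in b∈M
  firstUnspanned≡nothing⇒∈span {M} {b ∷ l} eq (here refl) | true = b∈M
  firstUnspanned≡nothing⇒∈span {M} {b ∷ l} eq (there a∈l) | true = firstUnspanned≡nothing⇒∈span eq a∈l
  firstUnspanned≡nothing⇒∈span {M} {b ∷ l} () a∈l | false

  firstUnspanned-dominated : ∀ {M M' l u u'} → Spans M M' →
    firstUnspanned M l ≡ just u → firstUnspanned M' l ≡ just u' → u' ≡ u ⊎ u' ∈span M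
  firstUnspanned-dominated {M} {M'} {b ∷ l} M⊒M' eq eq' with inSpan f M b in b∈M | inSpan f M' b in b∈M'
  ... | true  | true  = firstUnspanned-dominated {l = l} M⊒M' eq eq'
  firstUnspanned-dominated M⊒M' eq    refl | true  | false = inj₂ b∈M
  firstUnspanned-dominated M⊒M' refl  refl | false | false = inj₁ refl
  ... | false | true with trans (sym (spans-∈span M⊒M' b∈M')) b∈M
  ...   | ()

  newlySpanned-spanned : ∀ M u {a} → a ∈span M → newlySpanned M u a ≡ false
  newlySpanned-spanned M u {a} a∈M with inSpan f (M ∪ ⁅ u ⁆) a | inSpan f M a
  ... | true  | true = refl
  ... | false | true = refl
  newlySpanned-spanned M u () | _ | false

  newlySpanned-true : ∀ M u {a} → newlySpanned M u a ≡ true → a ∈span (M ∪ ⁅ u ⁆) × a ∉span M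
  newlySpanned-true M u {a} new with inSpan f (M ∪ ⁅ u ⁆) a | inSpan f M a
  newlySpanned-true M u refl | true  | false = refl , refl
  newlySpanned-true M u ()   | true  | true
  newlySpanned-true M u ()   | false | _

  newlySpanned-false : ∀ M u {a} → newlySpanned M u a ≡ false → a ∈span (M ∪ ⁅ u ⁆) → a ∈span M
  newlySpanned-false M u {a} old a∈M∪u with inSpan f (M ∪ ⁅ u ⁆) a | inSpan f M a
  ... | _ | true = refl
  newlySpanned-false M u () a∈M∪u | true  | false
  newlySpanned-false M u old ()   | false | false

  step-∈span : ∀ s x {a} → a ∈span ML s → a ∈span ML (step s x)
  step-∈span s x a∈M with firstUnspanned (ML s) (σ x)
  ... | nothing = a∈M
  ... | just u  = spans⇒inSpan (spans-weaken ⁅ u ⁆ (inSpan⇒spans a∈M))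

  step-∉span : ∀ s x {a} → a ∉span ML (step s x) → a ∉span ML s
  step-∉span s x {a} a∉M' with inSpan f (ML s) a in a∈M
  ... | false = refl
  ... | true  = trans (sym (step-∈span s x a∈M)) a∉M'

  step-spans : ∀ s x {X} → Spans (ML s) X → Spans (ML (step s x)) X
  step-spans s x M⊒X with firstUnspanned (ML s) (σ x)
  ... | nothing = M⊒X
  ... | just u  = spans-weaken ⁅ u ⁆ M⊒X

  step-dominates : ∀ s s' x → Spans (ML s) (ML s') → Spans (ML (step s x)) (ML (step s' x))
  step-dominates s s' x M⊒M' with firstUnspanned (ML s) (σ x) in eq | firstUnspanned (ML s') (σ x) in eq'
  ... | nothing | nothing = M⊒M'
  ... | just u  | nothing = spans-weaken ⁅ u ⁆ M⊒M'
  ... | nothing | just u' = spans-∪ M⊒M' (inSpan⇒spans (firstUnspanned≡nothing⇒∈span {l = σ x} eq (firstUnspanned-∈ eq')))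
  ... | just u  | just u' with firstUnspanned-dominated {l = σ x} M⊒M' eq eq'
  ...   | inj₁ refl = spans-∪ (spans-weaken ⁅ u ⁆ M⊒M') (spans-self (ML s) ⁅ u ⁆)
  ...   | inj₂ u'∈M = spans-∪ (spans-weaken ⁅ u ⁆ M⊒M') (spans-weaken ⁅ u ⁆ (inSpan⇒spans u'∈M))

  step-y-spanned : ∀ s x {w} → w ∈span ML s → y (step s x) w ≡ y s w
  step-y-spanned s x w∈M with firstUnspanned (ML s) (σ x)
  ... | nothing = refl
  ... | just u rewrite newlySpanned-spanned (ML s) u w∈M = refl

  step-y : ∀ s x w →
    (y (step s x) w ≡ y s w × (w ∈span ML (step s x) → w ∈span ML s))
    ⊎ y (step s x) w ≡ dualValue (t x)
  step-y s x w with firstUnspanned (ML s) (σ x)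
  ... | nothing = inj₁ (refl , id)
  ... | just u with newlySpanned (ML s) u w in new
  ...   | true  = inj₂ refl
  ...   | false = inj₁ (refl , newlySpanned-false (ML s) u new)

  step-ySetAt : ∀ s x w →
    ySetAt (step s x) w ≡ ySetAt s w
    ⊎ (ySetAt (step s x) w ≡ just (t x) × w ∈span ML (step s x) × w ∉span ML s)
  step-ySetAt s x w with firstUnspanned (ML s) (σ x)
  ... | nothing = inj₁ refl
  ... | just u with newlySpanned (ML s) u w in new
  ...   | true  = inj₂ (refl , newlySpanned-true (ML s) u new)
  ...   | false = inj₁ refl

  module Comparison (w : Fin nL) (t-bounds : ∀ v' → (0# ≤ t v') × (t v' ≤ 1#)) where
    open IsTotalOrder ≤-isTotalOrder using () renaming (reflexive to ≤-reflexive)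

    threshold : State → Carrier
    threshold s = maybe id 1# (ySetAt s w)

    -- s is the full run and s' the reduced one, with rest still to arrive.  Since the full run
    -- sets y_w exactly when w enters its span, `ahead` says that it did so before every
    -- remaining arrival as long as the reduced run has not caught up.
    record Invariant (s s' : State) (rest : List (Fin nR)) : Set where
      field
        dominates    : Spans (ML s) (ML s')
        ahead        : w ∈span ML s → w ∉span ML s' → All (λ b → dualValue (t b) ≤ y s w) rest
        bound        : dualValue (threshold s') ≤ y s w
        set⇒spanned : ∀ {c} → ySetAt s' w ≡ just c → w ∈span ML s'

    ahead-step : ∀ s s' s'' x rest → All (λ b → t x ≤ t b) rest → (w ∉span ML s'' → w ∉span ML s') →
      (w ∈span ML s → w ∉span ML s' → All (λ b → dualValue (t b) ≤ y s w) (x ∷ rest)) →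
      w ∈span ML (step s x) → w ∉span ML s'' → All (λ b → dualValue (t b) ≤ y (step s x) w) rest
    ahead-step s s' s'' x rest x≤rest shrink ahead w∈M w∉M'' with step-y s x w
    ... | inj₂ y≡ = All.map (λ x≤b → subst (_ ≤_) (sym y≡) (dualValue-antimono (proj₁ (t-bounds x)) x≤b)) x≤rest
    ... | inj₁ (y≡ , back) with ahead (back w∈M) (shrink w∉M'')
    ...   | _ ∷ rest≤y = All.map (subst (_ ≤_) (sym y≡)) rest≤y

    threshold-cases : ∀ s' → (Σ Carrier λ c → ySetAt s' w ≡ just c) ⊎ threshold s' ≡ 1#
    threshold-cases s' with ySetAt s' w
    ... | just c  = inj₁ (c , refl)
    ... | nothing = inj₂ refl

    bound-step : ∀ s s' x → Spans (ML s) (ML s') → (∀ {c} → ySetAt s' w ≡ just c → w ∈span ML s') →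
      dualValue (threshold s') ≤ y s w → dualValue (threshold s') ≤ y (step s x) w
    bound-step s s' x M⊒M' set⇒spanned bound with threshold-cases s'
    ... | inj₁ (_ , set) = subst (_ ≤_) (sym (step-y-spanned s x (spans-∈span M⊒M' (set⇒spanned set)))) bound
    ... | inj₂ th≡1 with step-y s x w
    ...   | inj₁ (y≡ , _) = subst (_ ≤_) (sym y≡) bound
    ...   | inj₂ y≡ = subst₂ _≤_ (cong dualValue (sym th≡1)) (sym y≡)
                        (dualValue-antimono (proj₁ (t-bounds x)) (proj₂ (t-bounds x)))

    bound-step-both : ∀ s s' x rest → Invariant s s' (x ∷ rest) →
      dualValue (threshold (step s' x)) ≤ y (step s x) w
    bound-step-both s s' x rest inv with step-ySetAt s' x w
    ... | inj₁ set≡ =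
      subst (λ c → dualValue c ≤ _) (cong (maybe id 1#) (sym set≡)) (bound-step s s' x dominates set⇒spanned bound)
      where open Invariant inv
    ... | inj₂ (set≡ , w∈M' , w∉M') = subst (λ c → dualValue c ≤ _) (cong (maybe id 1#) (sym set≡)) tx≤y
      where
      open Invariant inv
      tx≤y : dualValue (t x) ≤ y (step s x) w
      tx≤y with step-y s x w
      ... | inj₂ y≡ = ≤-reflexive (sym y≡)
      ... | inj₁ (y≡ , back) with ahead (back (spans-∈span (step-dominates s s' x dominates) w∈M')) w∉M'
      ...   | tx≤y ∷ _ = subst (_ ≤_) (sym y≡) tx≤y

    step-invariant-skip : ∀ s s' x rest → All (λ b → t x ≤ t b) rest →
      Invariant s s' (x ∷ rest) → Invariant (step s x) s' rest
    step-invariant-skip s s' x rest x≤rest inv = record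
      { dominates    = step-spans s x dominates
      ; ahead        = ahead-step s s' s' x rest x≤rest id ahead
      ; bound        = bound-step s s' x dominates set⇒spanned bound
      ; set⇒spanned = set⇒spanned
      }
      where open Invariant inv

    step-invariant-both : ∀ s s' x rest → All (λ b → t x ≤ t b) rest →
      Invariant s s' (x ∷ rest) → Invariant (step s x) (step s' x) rest
    step-invariant-both s s' x rest x≤rest inv = record
      { dominates    = step-dominates s s' x dominates
      ; ahead        = ahead-step s s' (step s' x) x rest x≤rest (step-∉span s' x) ahead
      ; bound        = bound-step-both s s' x rest inv
      ; set⇒spanned = set⇒spanned'
      }
      where
      open Invariant inv
      set⇒spanned' : ∀ {c} → ySetAt (step s' x) w ≡ just c → w ∈span ML (step s' x)
      set⇒spanned' set with step-ySetAt s' x w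
      ... | inj₁ set≡ = step-∈span s' x (set⇒spanned (trans (sym set≡) set))
      ... | inj₂ (_ , w∈M' , _) = w∈M'

    initial-invariant : ∀ rest → Invariant initial initial rest
    initial-invariant rest = record
      { dominates    = cong f (∪-idem Subset.⊥)
      ; ahead        = λ w∈∅ w∉∅ → contradiction (trans (sym w∈∅) w∉∅) λ ()
      ; bound        = dualValue-1≤0
      ; set⇒spanned = λ ()
      }

    threshold-bound : ∀ v rest s s' → AllPairs (λ a b → t a ≤ t b) rest → Invariant s s' rest →
      dualValue (threshold (foldl step s' (removeVertex v rest))) ≤ y (foldl step s rest) w
    threshold-bound v [] s s' [] inv = Invariant.bound inv
    threshold-bound v (x ∷ rest) s s' (x≤rest ∷ sorted) inv with x ≟ᶠ v
    ... | yes _ = threshold-bound v rest (step s x) s' sorted (step-invariant-skip s s' x rest x≤rest inv)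
    ... | no _  = threshold-bound v rest (step s x) (step s' x) sorted (step-invariant-both s s' x rest x≤rest inv)

mainTheorem12 : (ℝ : OrderedFieldExp) → let open OrderedFieldExp ℝ in
    {nL nR : ℕ} (I : Instance nL nR) (w : Fin nL) (v : Fin nR) →
    Instance.E I w v ≡ true →
    (t : Fin nR → Carrier) →
    (∀ v' → (0# ≤ t v') × (t v' ≤ 1#)) →
    (order : List (Fin nR)) → IsArrivalOrder ℝ t order →
    let tc = maybe id 1# (Greedy.State.ySetAt (Greedy.run ℝ I t (removeVertex v order)) w)
    in (1# + α) * (1# - g tc) ≤ Greedy.State.y (Greedy.run ℝ I t order) w
mainTheorem12 ℝ I w v _ t t-bounds order (_ , sorted) =
  threshold-bound v order initial initial
    (Linked⇒AllPairs (IsTotalOrder.trans (OrderedFieldExp.≤-isTotalOrder ℝ)) sorted)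
    (initial-invariant order)
  where
  open Greedy ℝ I t using (initial)
  open GreedyProperties ℝ I t
  open Comparison w t-bounds
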